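{- Let $\sigma$ satisfy $\log \sigma = \Omega(\log \log n)$. Any encoding data structure that indexes an arbitrary string $S[1..n]$ over the alphabet $[\sigma] = \{1,\ldots,\sigma\}$ and which, given any pattern $P[1..m]$ with $m = \lg n$, establishes whether $P$ has at least one order-preserving occurrence in $S$, must use $\Omega(n \log \log n)$ bits of space (in the worst case over strings $S$).
   Context: For a sequence $X[1..k]$ over a totally ordered alphabet, the rank encoding $E(X)[1..k]$ is defined by: $E(X)[i] = 0.5$ if $X[i]$ is smaller than every element of $T_i = \{X[1],\ldots,X[i-1]\}$; $E(X)[i] = j$ if $X[i]$ equals the $j$th smallest element of $T_i$; $E(X)[i] = j+0.5$ if $X[i]$ lies strictly between the $j$th and $(j+1)$st smallest elements of $T_i$; $E(X)[i] = |T_i| + 0.5$ if $X[i]$ is larger than every element of $T_i$. $P[1..m]$ has an order-preserving occurrence in $S$ iff there is a position $i$ with $E(S[i..i+m-1]) = E(P)$. -}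

module Defs where

open import Data.Nat using (ℕ; zero; suc; _+_; _*_; _≤_; _<?_)
open import Data.Nat.Properties using (_≟_)
open import Data.Nat.Logarithm using (⌊log₂_⌋)
open import Data.Fin using (Fin; toℕ)
open import Data.Bool using (Bool; true)
open import Data.List using (List; []; _∷_; _++_; length; filter; deduplicate; take; drop)
open import Data.List.Membership.DecPropositional _≟_ using (_∈?_)
open import Data.Vec using (Vec; toList)
import Data.Vec as V
open import Data.Product using (Σ; _×_)
open import Relation.Binary.PropositionalEquality using (_≡_)
open import Relation.Nullary using (Dec; yes; no)
open import Function.Bundles using (_⇔_)

-- Rank-encoding symbols are stored DOUBLED so they are natural numbers:
--   0.5 ↦ 1,  j ↦ 2j,  j+0.5 ↦ 2j+1,  |T|+0.5 ↦ 2|T|+1.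
-- With k = number of distinct elements of T strictly smaller than x:
--   x ∈ T  (x is the (k+1)-th smallest)  ↦ 2(k+1) = 2k+2
--   x ∉ T  (x lies above exactly k elements) ↦ 2k+1
rankSymbol : List ℕ → ℕ → ℕ
rankSymbol T x with x ∈? T
... | yes _ = 2 * length (deduplicate _≟_ (filter (_<? x) T)) + 2
... | no  _ = 2 * length (deduplicate _≟_ (filter (_<? x) T)) + 1

rankEncAux : List ℕ → List ℕ → List ℕ
rankEncAux T [] = []
rankEncAux T (x ∷ xs) = rankSymbol T x ∷ rankEncAux (T ++ (x ∷ [])) xs

rankEnc : List ℕ → List ℕ
rankEnc = rankEncAux []

-- Sequences over the alphabet [σ] (represented by Fin σ, order of toℕ).
toNats : ∀ {σ k} → Vec (Fin σ) k → List ℕ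
toNats v = toList (V.map toℕ v)

-- P has an order-preserving occurrence in S (0-based start position i).
OPOccurs : ∀ {σ n m} → Vec (Fin σ) m → Vec (Fin σ) n → Set
OPOccurs {σ} {n} {m} P S =
  Σ ℕ λ i → (i + m ≤ n) × (rankEnc (take m (drop i (toNats S))) ≡ rankEnc (toNats P))

record OPPMEncoding (σ n m : ℕ) : Set where
  field
    encode  : Vec (Fin σ) n → List Bool
    query   : List Bool → Vec (Fin σ) m → Bool
    correct : ∀ S P → (query (encode S) P ≡ true) ⇔ OPOccurs P S

bitsUsed : ∀ {σ n m} → OPPMEncoding σ n m → Vec (Fin σ) n → ℕ
bitsUsed D S = length (OPPMEncoding.encode D S)

-- Take the strings that are concatenations of blocks of length m = ⌊lg n⌋ (plus zero padding), each
-- block being the run 0 1 … h, the index of the block written in base h, and a payload of k₂ base-h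
-- digits, all shifted into [1, h].  The leading run makes the rank encoding of a block injective, and a
-- block-shaped pattern cannot occur at an offset inside a block: there the window sees the next block's
-- 0 as a new minimum, while the pattern at that position lies above its own leading 0.  So the
-- patterns occurring in such a string determine all its blocks, an encoding must separate all
-- h^(k₂ B) of these strings, and one of them needs k₂ B lg h bits.  With h = 2^u and
-- u ≈ min(lg σ, lg lg n) the run and the index fill at most half of a block, and
-- k₂ B u = Ω(n lg lg n) because lg lg n = O(lg σ).

module Submission where

open import Defs
open import Data.Nat
open import Data.Nat.Properties
open import Data.Bool using (Bool; true; false)
open import Data.Empty using (⊥-elim)
open import Data.Fin using (Fin; toℕ; fromℕ<)
import Data.Fin as Fin
open import Data.Fin.Properties using (any?; injective⇒≤; fromℕ<-injective; toℕ-fromℕ<; toℕ-injective; toℕ<n)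
open import Data.List using (List; []; _∷_; _++_; length; filter; deduplicate; take; drop; map; concat; replicate; applyUpTo; upTo)
open import Data.List.Properties
  using (++-identityʳ; ++-assoc; ++-cancelˡ; ∷-injectiveˡ; ∷-injectiveʳ; filter-none; concat-++; map-injective; ≡-dec;
         length-applyUpTo; length-drop; length-++; length-map; length-replicate)
open import Data.List.Membership.Propositional using (_∈_; _∉_)
open import Data.List.Membership.Propositional.Properties
  using (∈-∃++; ∈-filter⁺; ∈-filter⁻; ∈-deduplicate⁺; ∈-deduplicate⁻; ∈-++⁺ˡ; ∈-upTo⁺; ∈-upTo⁻)
open import Data.List.Membership.Propositional.Properties.WithK using (unique∧set⇒bag)
open import Data.List.Membership.DecPropositional _≟_ using (_∈?_)
open import Data.List.Relation.Unary.All as All using (All; []; _∷_)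
open import Data.List.Relation.Unary.All.Properties
  using (map⁺; ++⁺; ++⁻ʳ; concat⁺; drop⁺; replicate⁺; applyUpTo⁺₁; all-upTo)
open import Data.List.Relation.Unary.Any using (here; there)
open import Data.List.Relation.Unary.Unique.DecPropositional.Properties _≟_ using (deduplicate-!; upTo⁺)
open import Data.List.Relation.Binary.BagAndSetEquality using (∼bag⇒↭)
open import Data.List.Relation.Binary.Permutation.Propositional.Properties using (↭-length)
import Data.Nat.Binary as ℕᵇ
open import Data.Nat.Binary using (ℕᵇ; 2[1+_]; 1+[2_])
open import Data.Nat.Binary.Properties using (2[1+_]-injective; 1+[2_]-injective) renaming (toℕ-injective to toℕᵇ-injective)
open import Data.Nat.DivMod using (_/_; _%_; m%n<n; m≡m%n+[m/n]*n; m<n*o⇒m/o<n; m/n*n≤m; m/n≤m; m≥n⇒m/n>0)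
open import Data.Nat.Induction using (<-rec)
open import Data.Nat.Logarithm using (⌊log₂_⌋; ⌊log₂⌋-mono-≤; ⌊log₂[2^n]⌋≡n; ⌊log₂⌊n/2⌋⌋≡⌊log₂n⌋∸1)
open import Data.Nat.Tactic.RingSolver using (solve-∀)
open import Data.Product using (Σ; _×_; _,_; proj₁; proj₂; map₁; ∃-syntax)
open import Data.Vec using (Vec; []; _∷_)
import Data.Vec as V
open import Data.Vec.Properties using (length-toList)
open import Function.Base using (id; _∘_)
open import Function.Bundles using (_⇔_; mk⇔; Equivalence)
open import Function.Definitions using (Injective)
open import Relation.Binary.Definitions using (DecidableEquality)
open import Relation.Binary.PropositionalEquality
open import Relation.Nullary using (Dec; yes; no; ¬_; contradiction)

++-injective : ∀ {A : Set} {xs xs′ ys ys′ : List A} → length xs ≡ length xs′ →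
               xs ++ ys ≡ xs′ ++ ys′ → xs ≡ xs′ × ys ≡ ys′
++-injective {xs = []}     {[]}       _ eq = refl , eq
++-injective {xs = x ∷ xs} {x′ ∷ xs′} l eq with refl ← ∷-injectiveˡ eq
  = map₁ (cong (x ∷_)) (++-injective (suc-injective l) (∷-injectiveʳ eq))

split-at : ∀ {A : Set} {k} (xs : List A) → k < length xs →
           ∃[ ys ] ∃[ y ] ∃[ zs ] xs ≡ ys ++ y ∷ zs × length ys ≡ k
split-at {k = zero}  (x ∷ xs) _ = [] , x , xs , refl , refl
split-at {k = suc k} (x ∷ xs) (s≤s k<) with ys , y , zs , refl , refl ← split-at xs k< = x ∷ ys , y , zs , refl , refl

take-++-length : ∀ {A : Set} (xs ys : List A) k → take (length xs + k) (xs ++ ys) ≡ xs ++ take k ys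
take-++-length []       ys k = refl
take-++-length (x ∷ xs) ys k = cong (x ∷_) (take-++-length xs ys k)

drop-++-length : ∀ {A : Set} (xs ys : List A) k → drop (length xs + k) (xs ++ ys) ≡ drop k ys
drop-++-length []       ys k = refl
drop-++-length (x ∷ xs) ys k = drop-++-length xs ys k

drop-++-≤ : ∀ {A : Set} k (xs ys : List A) → k ≤ length xs → drop k (xs ++ ys) ≡ drop k xs ++ ys
drop-++-≤ zero    xs       ys _         = refl
drop-++-≤ (suc k) (x ∷ xs) ys (s≤s k≤) = drop-++-≤ k xs ys k≤

take-length-++ : ∀ {A : Set} (xs ys : List A) → take (length xs) (xs ++ ys) ≡ xs
take-length-++ xs ys = begin
  take (length xs) (xs ++ ys)      ≡⟨ cong (λ k → take k (xs ++ ys)) (sym (+-identityʳ (length xs))) ⟩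
  take (length xs + 0) (xs ++ ys)  ≡⟨ take-++-length xs ys 0 ⟩
  xs ++ []                         ≡⟨ ++-identityʳ xs ⟩
  xs                               ∎
  where open ≡-Reasoning

length-concat : ∀ {A : Set} {m} {xss : List (List A)} → All (λ xs → length xs ≡ m) xss → length (concat xss) ≡ length xss * m
length-concat [] = refl
length-concat {xss = xs ∷ xss} (|xs| ∷ |xss|) = trans (length-++ xs) (cong₂ _+_ |xs| (length-concat |xss|))

map-injective-All : ∀ {A B : Set} {P : A → Set} {f : A → B} → (∀ {x y} → P x → P y → f x ≡ f y → x ≡ y) →
                    ∀ {xs ys} → All P xs → All P ys → map f xs ≡ map f ys → xs ≡ ys
map-injective-All f-injective []         []         _  = refl
map-injective-All f-injective (px ∷ pxs) (py ∷ pys) eq =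
  cong₂ _∷_ (f-injective px py (∷-injectiveˡ eq)) (map-injective-All f-injective pxs pys (∷-injectiveʳ eq))

rankEncAux-++ : ∀ T xs ys → rankEncAux T (xs ++ ys) ≡ rankEncAux T xs ++ rankEncAux (T ++ xs) ys
rankEncAux-++ T [] ys = cong (λ U → rankEncAux U ys) (sym (++-identityʳ T))
rankEncAux-++ T (x ∷ xs) ys = cong (rankSymbol T x ∷_) (begin
  rankEncAux (T ++ x ∷ []) (xs ++ ys)                                ≡⟨ rankEncAux-++ (T ++ x ∷ []) xs ys ⟩
  rankEncAux (T ++ x ∷ []) xs ++ rankEncAux ((T ++ x ∷ []) ++ xs) ys ≡⟨ cong (λ U → rankEncAux (T ++ x ∷ []) xs ++ rankEncAux U ys)
                                                                           (++-assoc T (x ∷ []) xs) ⟩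
  rankEncAux (T ++ x ∷ []) xs ++ rankEncAux (T ++ x ∷ xs) ys         ∎)
  where open ≡-Reasoning

smaller : List ℕ → ℕ → List ℕ
smaller T x = deduplicate _≟_ (filter (_<? x) T)

length-smaller : ∀ {T x} → (∀ {z} → z < x → z ∈ T) → length (smaller T x) ≡ x
length-smaller {T} {x} below = begin
  length (smaller T x) ≡⟨ ↭-length (∼bag⇒↭ (unique∧set⇒bag (deduplicate-! _) (upTo⁺ x) (mk⇔ to from))) ⟩
  length (upTo x)      ≡⟨ length-applyUpTo _ x ⟩
  x                    ∎
  where
  open ≡-Reasoning
  to : ∀ {z} → z ∈ smaller T x → z ∈ upTo x
  to z∈ = ∈-upTo⁺ (proj₂ (∈-filter⁻ (_<? x) {xs = T} (∈-deduplicate⁻ _≟_ (filter (_<? x) T) z∈)))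
  from : ∀ {z} → z ∈ upTo x → z ∈ smaller T x
  from z∈ = let z<x = ∈-upTo⁻ z∈ in ∈-deduplicate⁺ _≟_ (∈-filter⁺ (_<? x) (below z<x) z<x)

length-rankEncAux : ∀ T xs → length (rankEncAux T xs) ≡ length xs
length-rankEncAux T [] = refl
length-rankEncAux T (x ∷ xs) = cong suc (length-rankEncAux (T ++ x ∷ []) xs)

rankEnc-++-injectiveʳ : ∀ {xs xs′ ys ys′} → length xs ≡ length xs′ →
  rankEnc (xs ++ ys) ≡ rankEnc (xs′ ++ ys′) → rankEncAux xs ys ≡ rankEncAux xs′ ys′
rankEnc-++-injectiveʳ {xs} {xs′} {ys} {ys′} l eq = proj₂ (++-injective
  (trans (length-rankEncAux [] xs) (trans l (sym (length-rankEncAux [] xs′))))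
  (trans (sym (rankEncAux-++ [] xs ys)) (trans eq (rankEncAux-++ [] xs′ ys′))))

rankSymbol-∈ : ∀ {T x} → x ∈ T → rankSymbol T x ≡ 2 * length (smaller T x) + 2
rankSymbol-∈ {T} {x} x∈T with x ∈? T
... | yes _   = refl
... | no x∉T = contradiction x∈T x∉T

rankSymbol-∉ : ∀ {T x} → x ∉ T → rankSymbol T x ≡ 2 * length (smaller T x) + 1
rankSymbol-∉ {T} {x} x∉T with x ∈? T
... | yes x∈T = contradiction x∈T x∉T
... | no _    = refl

rankSymbol-≥ : ∀ T x → 2 * length (smaller T x) + 1 ≤ rankSymbol T x
rankSymbol-≥ T x with x ∈? T
... | yes _ = +-monoʳ-≤ (2 * length (smaller T x)) (s≤s z≤n)
... | no _  = ≤-refl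

rankSymbol-covered : ∀ {r T x} → (∀ {z} → z < r → z ∈ T) → x < r → rankSymbol T x ≡ 2 * x + 2
rankSymbol-covered {T = T} {x} covered x<r = begin
  rankSymbol T x                 ≡⟨ rankSymbol-∈ (covered x<r) ⟩
  2 * length (smaller T x) + 2   ≡⟨ cong (λ k → 2 * k + 2) (length-smaller (λ z<x → covered (<-trans z<x x<r))) ⟩
  2 * x + 2                      ∎
  where open ≡-Reasoning

rankSymbol-0-minimum : ∀ {T} → All (0 <_) T → rankSymbol T 0 ≡ 1
rankSymbol-0-minimum {T} positive = begin
  rankSymbol T 0                 ≡⟨ rankSymbol-∉ (λ 0∈T → <-irrefl refl (All.lookup positive 0∈T)) ⟩
  2 * length (smaller T 0) + 1   ≡⟨ cong (λ xs → 2 * length (deduplicate _≟_ xs) + 1) (filter-none (_<? 0) {xs = T} (All.tabulate (λ _ → n≮0))) ⟩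
  1                              ∎
  where open ≡-Reasoning

rankSymbol-above-0 : ∀ {T x} → 0 ∈ T → 0 < x → 3 ≤ rankSymbol T x
rankSymbol-above-0 {T} {x} 0∈T 0<x = begin
  3                              ≤⟨ +-monoˡ-≤ 1 (*-monoʳ-≤ 2 (nonEmpty (∈-deduplicate⁺ _≟_ (∈-filter⁺ (_<? x) {xs = T} 0∈T 0<x)))) ⟩
  2 * length (smaller T x) + 1   ≤⟨ rankSymbol-≥ T x ⟩
  rankSymbol T x                 ∎
  where
  open ≤-Reasoning
  nonEmpty : ∀ {z} {xs : List ℕ} → z ∈ xs → 1 ≤ length xs
  nonEmpty {xs = _ ∷ _} _ = s≤s z≤n

rankEncAux-injective : ∀ {r T xs ys} → (∀ {z} → z < r → z ∈ T) → All (_< r) xs → All (_< r) ys →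
                       rankEncAux T xs ≡ rankEncAux T ys → xs ≡ ys
rankEncAux-injective {xs = []}     {[]}     _       _              _              _  = refl
rankEncAux-injective {xs = x ∷ xs} {y ∷ ys} covered (x<r ∷ xs<r) (y<r ∷ ys<r) eq
  with refl ← *-cancelˡ-≡ x y 2 (+-cancelʳ-≡ 2 (2 * x) (2 * y)
    (trans (sym (rankSymbol-covered covered x<r)) (trans (∷-injectiveˡ eq) (rankSymbol-covered covered y<r))))
  = cong (x ∷_) (rankEncAux-injective (∈-++⁺ˡ ∘ covered) xs<r ys<r (∷-injectiveʳ eq))

-- At position |A| the left word has a new minimum (symbol 1), the right one a value above an earlier 0 (symbol ≥ 3).
rankEnc-new-minimum-≢ : ∀ {A W P₁ y P₂} → length A ≡ length P₁ → All (0 <_) A → 0 ∈ P₁ → 0 < y →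
                        rankEnc (A ++ 0 ∷ W) ≢ rankEnc (P₁ ++ y ∷ P₂)
rankEnc-new-minimum-≢ {A} {P₁ = P₁} {y} l positive 0∈P₁ 0<y eq =
  contradiction (subst (3 ≤_) (trans (sym same-symbol) (rankSymbol-0-minimum positive)) (rankSymbol-above-0 0∈P₁ 0<y))
                (λ { (s≤s ()) })
  where
  same-symbol : rankSymbol A 0 ≡ rankSymbol P₁ y
  same-symbol = ∷-injectiveˡ (rankEnc-++-injectiveʳ l eq)

rankEnc-0-after-positive-≢ : ∀ {A W p} → 0 < length A → length A ≤ length p → All (0 <_) A → All (0 <_) p →
                             rankEnc (A ++ 0 ∷ W) ≢ rankEnc (0 ∷ p)
rankEnc-0-after-positive-≢ {a ∷ A} {p = p} _ |A|<|p| A-positive p-positive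
  with P₁ , y , P₂ , refl , l ← split-at p |A|<|p|
  = rankEnc-new-minimum-≢ (cong suc (sym l)) A-positive (here refl) (All.lookup (++⁻ʳ P₁ p-positive) (here refl))

misaligned-window-≢ : ∀ {b p X i} → All (0 <_) b → All (0 <_) p → length b ≡ length p → i < length b →
  rankEnc (take (suc (length p)) (drop i (b ++ 0 ∷ X))) ≢ rankEnc (0 ∷ p)
misaligned-window-≢ {b} {p} {X} {i} b-positive p-positive |b|≡|p| i<|b| eq =
  rankEnc-0-after-positive-≢ {W = take i X}
    (subst (0 <_) (sym (length-drop i b)) (m<n⇒0<n∸m i<|b|))
    (subst (_≤ length p) (sym (length-drop i b)) (≤-trans (m∸n≤m (length b) i) (≤-reflexive |b|≡|p|)))
    (drop⁺ i b-positive) p-positive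
    (trans (cong rankEnc (sym window)) eq)
  where
  open ≡-Reasoning
  window : take (suc (length p)) (drop i (b ++ 0 ∷ X)) ≡ drop i b ++ 0 ∷ take i X
  window = begin
    take (suc (length p)) (drop i (b ++ 0 ∷ X))             ≡⟨ cong (take _) (drop-++-≤ i b _ (<⇒≤ i<|b|)) ⟩
    take (suc (length p)) (drop i b ++ 0 ∷ X)               ≡⟨ cong (λ k → take k (drop i b ++ 0 ∷ X)) split-length ⟩
    take (length (drop i b) + suc i) (drop i b ++ 0 ∷ X)    ≡⟨ take-++-length (drop i b) (0 ∷ X) (suc i) ⟩
    drop i b ++ 0 ∷ take i X                                ∎
    where
    split-length : suc (length p) ≡ length (drop i b) + suc i
    split-length = begin
      suc (length p)             ≡⟨ cong suc (sym |b|≡|p|) ⟩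
      suc (length b)             ≡⟨ cong suc (sym (m∸n+n≡m (<⇒≤ i<|b|))) ⟩
      suc (length b ∸ i + i)     ≡⟨ sym (+-suc (length b ∸ i) i) ⟩
      length b ∸ i + suc i       ≡⟨ cong (_+ suc i) (sym (length-drop i b)) ⟩
      length (drop i b) + suc i  ∎

Block : ℕ → ℕ → List ℕ → Set
Block r m b = length b ≡ m × ∃[ F ] b ≡ upTo r ++ F × All (λ z → 0 < z × z < r) F

Block-< : ∀ {r m b} → Block r m b → All (_< r) b
Block-< (_ , F , refl , F-range) = ++⁺ (all-upTo _) (All.map proj₂ F-range)

Block-zero-headed : ∀ {r m b} → Block (suc r) m b → ∃[ b′ ] b ≡ 0 ∷ b′ × All (0 <_) b′
Block-zero-headed {r} (_ , F , refl , F-range) =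
  applyUpTo suc r ++ F , refl , ++⁺ (applyUpTo⁺₁ suc r (λ _ → s≤s z≤n)) (All.map proj₁ F-range)

-- The prefix 0 1 … r-1 makes every later letter below r readable from its rank symbol.
Block-rankEnc-injective : ∀ {r m m′ b b′} → Block r m b → Block r m′ b′ → rankEnc b ≡ rankEnc b′ → b ≡ b′
Block-rankEnc-injective {r} (_ , F , refl , F-range) (_ , F′ , refl , F′-range) eq =
  cong (upTo r ++_) (rankEncAux-injective ∈-upTo⁺ (All.map proj₂ F-range) (All.map proj₂ F′-range)
                                          (rankEnc-++-injectiveʳ refl eq))

OccursAt : ℕ → List ℕ → List ℕ → Set
OccursAt i p X = i + length p ≤ length X × rankEnc (take (length p) (drop i X)) ≡ rankEnc p

Occurs : List ℕ → List ℕ → Set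
Occurs p X = ∃[ i ] OccursAt i p X

OccursAt-++⁺ : ∀ {i p} xs {X} → OccursAt i p X → OccursAt (length xs + i) p (xs ++ X)
OccursAt-++⁺ {i} {p} xs {X} (fits , eq) =
  subst₂ _≤_ (sym (+-assoc (length xs) i (length p))) (sym (length-++ xs)) (+-monoʳ-≤ (length xs) fits) ,
  trans (cong (λ Y → rankEnc (take (length p) Y)) (drop-++-length xs X i)) eq

OccursAt-++⁻ : ∀ {i p} xs {X} → OccursAt (length xs + i) p (xs ++ X) → OccursAt i p X
OccursAt-++⁻ {i} {p} xs {X} (fits , eq) =
  +-cancelˡ-≤ (length xs) _ _ (subst₂ _≤_ (+-assoc (length xs) i (length p)) (length-++ xs) fits) ,
  trans (cong (λ Y → rankEnc (take (length p) Y)) (sym (drop-++-length xs X i))) eq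

∈⇒Occurs : ∀ {p bs} Y → p ∈ bs → Occurs p (concat bs ++ Y)
∈⇒Occurs {p} {bs} Y p∈bs with before , after , refl ← ∈-∃++ p∈bs =
  length (concat before) + 0 , subst (OccursAt (length (concat before) + 0) p) text≡
    (OccursAt-++⁺ (concat before) (subst (length p ≤_) (sym (length-++ p)) (m≤m+n _ _) ,
                                    cong rankEnc (take-length-++ p _)))
  where
  text≡ : concat before ++ p ++ concat after ++ Y ≡ concat (before ++ p ∷ after) ++ Y
  text≡ = begin
    concat before ++ p ++ concat after ++ Y       ≡⟨ cong (concat before ++_) (sym (++-assoc p (concat after) Y)) ⟩
    concat before ++ (p ++ concat after) ++ Y     ≡⟨ sym (++-assoc (concat before) (p ++ concat after) Y) ⟩
    (concat before ++ p ++ concat after) ++ Y     ≡⟨ cong (_++ Y) (concat-++ before (p ∷ after)) ⟩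
    concat (before ++ p ∷ after) ++ Y             ∎
    where open ≡-Reasoning

tiling-zero-headed : ∀ {r m z bs} → All (Block (suc r) m) bs → 0 < length (concat bs ++ replicate z 0) →
                     ∃[ X ] concat bs ++ replicate z 0 ≡ 0 ∷ X
tiling-zero-headed {z = suc z} [] _ = replicate z 0 , refl
tiling-zero-headed {bs = _ ∷ bs} (b-block ∷ _) _ with b′ , refl , _ ← Block-zero-headed b-block =
  b′ ++ concat bs ++ _ , cong (0 ∷_) (++-assoc b′ (concat bs) _)

aligned-occurrence : ∀ {r m b p X} → Block r m b → Block r m p → OccursAt 0 p (b ++ X) → b ≡ p
aligned-occurrence {b = b} {p} {X} b-block p-block (_ , eq) =
  Block-rankEnc-injective b-block p-block (begin
    rankEnc b                             ≡⟨ cong rankEnc (sym (take-length-++ b X)) ⟩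
    rankEnc (take (length b) (b ++ X))    ≡⟨ cong (λ k → rankEnc (take k (b ++ X))) (trans (proj₁ b-block) (sym (proj₁ p-block))) ⟩
    rankEnc (take (length p) (b ++ X))    ≡⟨ eq ⟩
    rankEnc p                             ∎)
  where open ≡-Reasoning

misaligned-occurrence : ∀ {r m b p X i} → Block (suc r) m b → Block (suc r) m p → suc i < m →
                        ¬ OccursAt (suc i) p (b ++ 0 ∷ X)
misaligned-occurrence b-block p-block i<m (_ , eq)
  with b′ , refl , b′-positive ← Block-zero-headed b-block | p′ , refl , p′-positive ← Block-zero-headed p-block
  = misaligned-window-≢ b′-positive p′-positive (suc-injective (trans (proj₁ b-block) (sym (proj₁ p-block))))
                        (s≤s⁻¹ (subst (_ <_) (sym (proj₁ b-block)) i<m)) eq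

OccursAt-overhang : ∀ {i p} {b X : List ℕ} → length p ≡ length b → OccursAt (suc i) p (b ++ X) → 0 < length X
OccursAt-overhang {i} {p} {b} {X} |p|≡|b| (fits , _) = +-cancelˡ-≤ (length b) 1 (length X)
  (≤-trans (≤-reflexive (+-comm (length b) 1)) (≤-trans (+-monoˡ-≤ (length b) (s≤s z≤n))
  (subst₂ (λ k l → suc i + k ≤ l) |p|≡|b| (length-++ b) fits)))

Occurs-tiling⇒∈ : ∀ {r m z p} bs → All (Block (suc r) m) bs → Block (suc r) m p → z < m →
                  Occurs p (concat bs ++ replicate z 0) → p ∈ bs
Occurs-tiling⇒∈ {m = m} {z} {p} [] _ p-block z<m (i , fits , _) =
  contradiction (≤-trans (m≤n+m m i) (subst₂ (λ k l → i + k ≤ l) (proj₁ p-block) (length-replicate z) fits)) (<⇒≱ z<m)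
Occurs-tiling⇒∈ {m = m} {z} {p} (b ∷ bs) (b-block ∷ bs-blocks) p-block z<m (i , occ) =
  located (m ≤? i) (subst (OccursAt i p) (++-assoc b (concat bs) (replicate z 0)) occ)
  where
  X = concat bs ++ replicate z 0

  first-block : ∀ {i} → i < m → OccursAt i p (b ++ X) → b ≡ p
  first-block {zero}  _   occ = aligned-occurrence b-block p-block occ
  first-block {suc i} i<m occ
    with X′ , X≡ ← tiling-zero-headed bs-blocks
                     (OccursAt-overhang {b = b} {X} (trans (proj₁ p-block) (sym (proj₁ b-block))) occ) =
    contradiction (subst (λ Y → OccursAt (suc i) p (b ++ Y)) X≡ occ) (misaligned-occurrence b-block p-block i<m)

  located : Dec (m ≤ i) → OccursAt i p (b ++ X) → p ∈ b ∷ bs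
  located (yes m≤i) occ =
    there (Occurs-tiling⇒∈ bs bs-blocks p-block z<m (i ∸ m , OccursAt-++⁻ b (subst (λ k → OccursAt k p (b ++ X)) i≡ occ)))
    where
    i≡ : i ≡ length b + (i ∸ m)
    i≡ = trans (sym (m+[n∸m]≡n m≤i)) (cong (_+ (i ∸ m)) (sym (proj₁ b-block)))
  located (no i≱m)  occ = here (sym (first-block (≰⇒> i≱m) occ))

digits : ∀ b .{{_ : NonZero b}} → ℕ → ℕ → List ℕ
digits b zero    x = []
digits b (suc k) x = x % b ∷ digits b k (x / b)

length-digits : ∀ b .{{_ : NonZero b}} k x → length (digits b k x) ≡ k
length-digits b zero    x = refl
length-digits b (suc k) x = cong suc (length-digits b k (x / b))

digits-< : ∀ b .{{_ : NonZero b}} k x → All (_< b) (digits b k x)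
digits-< b zero    x = []
digits-< b (suc k) x = m%n<n x b ∷ digits-< b k (x / b)

digits-injective : ∀ b .{{_ : NonZero b}} k {x y} → x < b ^ k → y < b ^ k → digits b k x ≡ digits b k y → x ≡ y
digits-injective b zero    (s≤s z≤n) (s≤s z≤n) _ = refl
digits-injective b (suc k) {x} {y} x< y< eq = begin
  x                     ≡⟨ m≡m%n+[m/n]*n x b ⟩
  x % b + (x / b) * b   ≡⟨ cong₂ (λ r q → r + q * b) (∷-injectiveˡ eq) (digits-injective b k (quotient-< x<) (quotient-< y<) (∷-injectiveʳ eq)) ⟩
  y % b + (y / b) * b   ≡⟨ sym (m≡m%n+[m/n]*n y b) ⟩
  y                     ∎
  where
  open ≡-Reasoning
  quotient-< : ∀ {z} → z < b ^ suc k → z / b < b ^ k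
  quotient-< {z} z< = m<n*o⇒m/o<n (subst (z <_) (*-comm b (b ^ k)) z<)

module _ {A B : Set} (f : ℕ → A → B) where

  mapIndexedFrom : ℕ → List A → List B
  mapIndexedFrom j []       = []
  mapIndexedFrom j (x ∷ xs) = f j x ∷ mapIndexedFrom (suc j) xs

  length-mapIndexedFrom : ∀ j xs → length (mapIndexedFrom j xs) ≡ length xs
  length-mapIndexedFrom j []       = refl
  length-mapIndexedFrom j (x ∷ xs) = cong suc (length-mapIndexedFrom (suc j) xs)

  mapIndexedFrom⁺ : ∀ {P : A → Set} {Q : B → Set} → (∀ {i x} → P x → Q (f i x)) →
                    ∀ {j xs} → All P xs → All Q (mapIndexedFrom j xs)
  mapIndexedFrom⁺ P⇒Q []         = []
  mapIndexedFrom⁺ P⇒Q (px ∷ pxs) = P⇒Q px ∷ mapIndexedFrom⁺ P⇒Q pxs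

  ∈-mapIndexedFrom⁻ : ∀ {b} j xs → b ∈ mapIndexedFrom j xs → ∃[ i ] ∃[ x ] j ≤ i × i < j + length xs × b ≡ f i x
  ∈-mapIndexedFrom⁻ j (x ∷ xs) (here refl) = j , x , ≤-refl , m<m+n j z<s , refl
  ∈-mapIndexedFrom⁻ j (x ∷ xs) (there b∈) with i , y , j<i , i< , refl ← ∈-mapIndexedFrom⁻ (suc j) xs b∈ =
    i , y , <⇒≤ j<i , subst (i <_) (sym (+-suc j (length xs))) i< , refl

  module _ {N} (f-injective : ∀ {i i′ x x′} → i < N → i′ < N → f i x ≡ f i′ x′ → i ≡ i′ × x ≡ x′)
           (_≟_ : DecidableEquality A) where

    f-∉-mapIndexedFrom-suc : ∀ {j x} zs → suc j + length zs ≤ N → f j x ∉ mapIndexedFrom (suc j) zs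
    f-∉-mapIndexedFrom-suc {j} zs bound b∈ with i , _ , j<i , i< , eq ← ∈-mapIndexedFrom⁻ (suc j) zs b∈ =
      <-irrefl (proj₁ (f-injective (≤-trans (m≤m+n (suc j) _) bound) (≤-trans i< bound) eq)) j<i

    mapIndexedFrom-∉ : ∀ j xs ys → j + length xs ≤ N → length xs ≡ length ys → xs ≢ ys →
                       ∃[ b ] b ∈ mapIndexedFrom j xs × b ∉ mapIndexedFrom j ys
    mapIndexedFrom-∉ j []       []       _ _ xs≢ys = contradiction refl xs≢ys
    mapIndexedFrom-∉ j (x ∷ xs) (y ∷ ys) fits |xs|≡|ys| xs≢ys with x ≟ y
    ... | no x≢y = f j x , here refl , λ
      { (here eq)  → x≢y (proj₂ (f-injective j<N j<N eq))
      ; (there b∈) → f-∉-mapIndexedFrom-suc ys (subst (λ k → suc j + k ≤ N) (suc-injective |xs|≡|ys|) fits′) b∈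
      }
      where
      j<N = ≤-trans (m<m+n j z<s) fits
      fits′ = subst (_≤ N) (+-suc j (length xs)) fits
    ... | yes refl with b , b∈ , b∉ ← mapIndexedFrom-∉ (suc j) xs ys (subst (_≤ N) (+-suc j (length xs)) fits)
                                        (suc-injective |xs|≡|ys|) (λ eq → xs≢ys (cong (x ∷_) eq)) =
      b , there b∈ , λ
      { (here refl)  → f-∉-mapIndexedFrom-suc xs fits′ b∈
      ; (there b∈′) → b∉ b∈′
      }
      where fits′ = subst (_≤ N) (+-suc j (length xs)) fits

-- Bijective base 2: the 2^k − 1 bit strings shorter than k are numbered 0, 1, …, 2^k − 2.
bitsToℕᵇ : List Bool → ℕᵇ
bitsToℕᵇ []           = ℕᵇ.zero
bitsToℕᵇ (false ∷ bs) = 1+[2 bitsToℕᵇ bs ]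
bitsToℕᵇ (true  ∷ bs) = 2[1+ bitsToℕᵇ bs ]

bitsToℕᵇ-injective : Injective _≡_ _≡_ bitsToℕᵇ
bitsToℕᵇ-injective {[]}         {[]}         _  = refl
bitsToℕᵇ-injective {false ∷ bs} {false ∷ cs} eq = cong (false ∷_) (bitsToℕᵇ-injective (1+[2_]-injective eq))
bitsToℕᵇ-injective {true ∷ bs}  {true ∷ cs}  eq = cong (true ∷_) (bitsToℕᵇ-injective (2[1+_]-injective eq))
bitsToℕᵇ-injective {[]}         {false ∷ cs} ()
bitsToℕᵇ-injective {[]}         {true ∷ cs}  ()
bitsToℕᵇ-injective {false ∷ bs} {[]}         ()
bitsToℕᵇ-injective {false ∷ bs} {true ∷ cs}  ()
bitsToℕᵇ-injective {true ∷ bs}  {[]}         ()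
bitsToℕᵇ-injective {true ∷ bs}  {false ∷ cs} ()

bitsToℕᵇ-< : ∀ bs → 2 + ℕᵇ.toℕ (bitsToℕᵇ bs) ≤ 2 ^ suc (length bs)
bitsToℕᵇ-< []           = ≤-refl
bitsToℕᵇ-< (false ∷ bs) = begin
  3 + 2 * t      ≤⟨ n≤1+n _ ⟩
  4 + 2 * t      ≡⟨ sym (*-distribˡ-+ 2 2 t) ⟩
  2 * (2 + t)    ≤⟨ *-monoʳ-≤ 2 (bitsToℕᵇ-< bs) ⟩
  2 * 2 ^ suc (length bs) ∎
  where
  open ≤-Reasoning
  t = ℕᵇ.toℕ (bitsToℕᵇ bs)
bitsToℕᵇ-< (true ∷ bs)  = begin
  2 + 2 * suc t  ≡⟨ cong (2 +_) (*-suc 2 t) ⟩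
  4 + 2 * t      ≡⟨ sym (*-distribˡ-+ 2 2 t) ⟩
  2 * (2 + t)    ≤⟨ *-monoʳ-≤ 2 (bitsToℕᵇ-< bs) ⟩
  2 * 2 ^ suc (length bs) ∎
  where
  open ≤-Reasoning
  t = ℕᵇ.toℕ (bitsToℕᵇ bs)

∃-long-image : ∀ {N} E (G : Fin N → List Bool) → Injective _≡_ _≡_ G → 2 ^ E ≤ N → ∃[ i ] E ≤ length (G i)
∃-long-image {N} E G G-injective 2^E≤N with any? (λ i → E ≤? length (G i))
... | yes long = long
... | no  none = ⊥-elim (<-irrefl refl (m≤pred[n]⇒suc[m]≤n {{m^n≢0 2 E}} (≤-trans 2^E≤N (injective⇒≤ code-injective))))
  where
  code-< : ∀ i → ℕᵇ.toℕ (bitsToℕᵇ (G i)) < pred (2 ^ E)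
  code-< i = pred-mono-≤ (≤-trans (bitsToℕᵇ-< (G i)) (^-monoʳ-≤ 2 (≰⇒> (λ long → none (i , long)))))
  code : Fin N → Fin (pred (2 ^ E))
  code i = fromℕ< (code-< i)
  code-injective : Injective _≡_ _≡_ code
  code-injective eq = G-injective (bitsToℕᵇ-injective (toℕᵇ-injective (fromℕ<-injective _ _ (code-< _) (code-< _) eq)))

length-toNats : ∀ {σ k} (v : Vec (Fin σ) k) → length (toNats v) ≡ k
length-toNats v = length-toList (V.map toℕ v)

Occurs⇔OPOccurs : ∀ {σ n m} (P : Vec (Fin σ) m) (S : Vec (Fin σ) n) → Occurs (toNats P) (toNats S) ⇔ OPOccurs P S
Occurs⇔OPOccurs P S rewrite length-toNats P | length-toNats S = mk⇔ id id

fromNats : ∀ {σ k} xs → length xs ≡ k → All (_< σ) xs → ∃[ v ] toNats {σ} {k} v ≡ xs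
fromNats {k = zero}  []       _ _            = [] , refl
fromNats {k = suc k} (x ∷ xs) l (x<σ ∷ xs<σ) with v , refl ← fromNats xs (suc-injective l) xs<σ =
  fromℕ< x<σ ∷ v , cong (_∷ toNats v) (toℕ-fromℕ< x<σ)

encode-determines-OPOccurs : ∀ {σ n m} (D : OPPMEncoding σ n m) {S S′ P} →
  OPPMEncoding.encode D S ≡ OPPMEncoding.encode D S′ → OPOccurs P S → OPOccurs P S′
encode-determines-OPOccurs D {S} {S′} {P} same occ =
  Equivalence.to (correct S′ P) (subst (λ code → query code P ≡ true) same (Equivalence.from (correct S P) occ))
  where open OPPMEncoding D

record Layout (s n m : ℕ) : Set where
  field
    h k₁ k₂ B z  : ℕ
    {{h≢0}}      : NonZero h
    h<s          : h < s
    block-length : suc h + (k₁ + k₂) ≡ m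
    n≡B*m+z      : B * m + z ≡ n
    z<m          : z < m
    B≤h^k₁       : B ≤ h ^ k₁

module Strings {s n m} (ℓ : Layout s n m) where
  open Layout ℓ

  H : ℕ
  H = h ^ k₂

  instance
    H≢0 : NonZero H
    H≢0 = m^n≢0 h k₂

  block : ℕ → List ℕ → List ℕ
  block j c = upTo (suc h) ++ map suc (digits h k₁ j ++ c)

  Payload : List ℕ → Set
  Payload c = length c ≡ k₂ × All (_< h) c

  payload : ℕ → List (List ℕ)
  payload d = map (digits h k₂) (digits H B d)

  blocks : ℕ → List (List ℕ)
  blocks d = mapIndexedFrom block 0 (payload d)

  text : ℕ → List ℕ
  text d = concat (blocks d) ++ replicate z 0

  payload-Payload : ∀ d → All Payload (payload d)
  payload-Payload d = map⁺ (All.universal (λ x → length-digits h k₂ x , digits-< h k₂ x) _)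

  payload-injective : ∀ {d d′} → d < H ^ B → d′ < H ^ B → payload d ≡ payload d′ → d ≡ d′
  payload-injective {d} {d′} d< d′< eq =
    digits-injective H B d< d′< (map-injective-All (digits-injective h k₂) (digits-< H B d) (digits-< H B d′) eq)

  length-payload : ∀ d → length (payload d) ≡ B
  length-payload d = trans (length-map (digits h k₂) (digits H B d)) (length-digits H B d)

  length-block : ∀ j {c} → Payload c → length (block j c) ≡ m
  length-block j {c} (|c|≡k₂ , _) = begin
    length (block j c)                                        ≡⟨ length-++ (upTo (suc h)) ⟩
    length (upTo (suc h)) + length (map suc (digits h k₁ j ++ c)) ≡⟨ cong₂ _+_ (length-applyUpTo id (suc h)) (length-map suc (digits h k₁ j ++ c)) ⟩
    suc h + length (digits h k₁ j ++ c)                       ≡⟨ cong (suc h +_) (length-++ (digits h k₁ j)) ⟩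
    suc h + (length (digits h k₁ j) + length c)               ≡⟨ cong (λ k → suc h + (k + length c)) (length-digits h k₁ j) ⟩
    suc h + (k₁ + length c)                                   ≡⟨ cong (λ k → suc h + (k₁ + k)) |c|≡k₂ ⟩
    suc h + (k₁ + k₂)                                         ≡⟨ block-length ⟩
    m                                                         ∎
    where open ≡-Reasoning

  block-Block : ∀ j {c} → Payload c → Block (suc h) m (block j c)
  block-Block j {c} c-payload@(_ , c<h) =
    length-block j c-payload , map suc (digits h k₁ j ++ c) , refl ,
    map⁺ (All.map (λ x<h → s≤s z≤n , s≤s x<h) (++⁺ (digits-< h k₁ j) c<h))

  block-injective : ∀ {j j′ c c′} → j < h ^ k₁ → j′ < h ^ k₁ → block j c ≡ block j′ c′ → j ≡ j′ × c ≡ c′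
  block-injective {j} {j′} j< j′< eq
    with digits≡ , c≡ ← ++-injective (trans (length-digits h k₁ j) (sym (length-digits h k₁ j′)))
                                     (map-injective suc-injective (++-cancelˡ (upTo (suc h)) _ _ eq))
    = digits-injective h k₁ j< j′< digits≡ , c≡

  blocks-Block : ∀ d → All (Block (suc h) m) (blocks d)
  blocks-Block d = mapIndexedFrom⁺ block (block-Block _) (payload-Payload d)

  length-text : ∀ d → length (text d) ≡ n
  length-text d = begin
    length (concat (blocks d) ++ replicate z 0)         ≡⟨ length-++ (concat (blocks d)) ⟩
    length (concat (blocks d)) + length (replicate z 0) ≡⟨ cong₂ _+_ (length-concat (All.map proj₁ (blocks-Block d))) (length-replicate z) ⟩
    length (blocks d) * m + z                           ≡⟨ cong (λ k → k * m + z) (trans (length-mapIndexedFrom block 0 (payload d)) (length-payload d)) ⟩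
    B * m + z                                           ≡⟨ n≡B*m+z ⟩
    n                                                   ∎
    where open ≡-Reasoning

  text-< : ∀ d → All (_< s) (text d)
  text-< d = ++⁺ (concat⁺ (All.map (λ b-block → All.map (λ x≤h → <-≤-trans x≤h h<s) (Block-< b-block)) (blocks-Block d)))
                 (replicate⁺ z (<-≤-trans z<s h<s))

  string : Fin (H ^ B) → Vec (Fin s) n
  string d = proj₁ (fromNats (text (toℕ d)) (length-text _) (text-< _))

  toNats-string : ∀ d → toNats (string d) ≡ text (toℕ d)
  toNats-string d = proj₂ (fromNats (text (toℕ d)) (length-text _) (text-< _))

  distinguishing-block : ∀ {d d′ : Fin (H ^ B)} → d ≢ d′ → ∃[ b ] b ∈ blocks (toℕ d) × b ∉ blocks (toℕ d′)
  distinguishing-block {d} {d′} d≢d′ =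
    mapIndexedFrom-∉ block block-injective (≡-dec _≟_) 0 (payload (toℕ d)) (payload (toℕ d′))
      (subst (_≤ h ^ k₁) (sym (length-payload (toℕ d))) B≤h^k₁)
      (trans (length-payload (toℕ d)) (sym (length-payload (toℕ d′))))
      (λ eq → d≢d′ (toℕ-injective (payload-injective (toℕ<n d) (toℕ<n d′) eq)))

  encode∘string-injective : (D : OPPMEncoding s n m) → Injective _≡_ _≡_ (OPPMEncoding.encode D ∘ string)
  encode∘string-injective D {d} {d′} same with d Fin.≟ d′
  ... | yes d≡d′ = d≡d′
  ... | no  d≢d′ with b , b∈ , b∉ ← distinguishing-block d≢d′ =
    contradiction (Occurs-tiling⇒∈ (blocks (toℕ d′)) (blocks-Block _) b-Block z<m b-occurs′) b∉
    where
    b-Block = All.lookup (blocks-Block (toℕ d)) b∈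
    P = fromNats {s} {m} b (proj₁ b-Block) (All.map (λ x≤h → <-≤-trans x≤h h<s) (Block-< b-Block))
    b-occurs : OPOccurs (proj₁ P) (string d)
    b-occurs = Equivalence.to (Occurs⇔OPOccurs (proj₁ P) (string d))
      (subst₂ Occurs (sym (proj₂ P)) (sym (toNats-string d)) (∈⇒Occurs (replicate z 0) b∈))
    b-occurs′ : Occurs b (text (toℕ d′))
    b-occurs′ = subst₂ Occurs (proj₂ P) (toNats-string d′)
      (Equivalence.from (Occurs⇔OPOccurs (proj₁ P) (string d′)) (encode-determines-OPOccurs D same b-occurs))

Layout-lower-bound : ∀ {s n m} (ℓ : Layout s n m) (D : OPPMEncoding s n m) E →
                     2 ^ E ≤ (Layout.h ℓ ^ Layout.k₂ ℓ) ^ Layout.B ℓ → ∃[ S ] E ≤ bitsUsed D S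
Layout-lower-bound ℓ D E 2^E≤ =
  let d , long = ∃-long-image E (OPPMEncoding.encode D ∘ string) (encode∘string-injective D) 2^E≤
  in string d , long
  where open Strings ℓ

⌊log₂⌋-≥ : ∀ {k n} → 2 ^ k ≤ n → k ≤ ⌊log₂ n ⌋
⌊log₂⌋-≥ {k} {n} 2^k≤n = subst (_≤ ⌊log₂ n ⌋) (⌊log₂[2^n]⌋≡n k) (⌊log₂⌋-mono-≤ 2^k≤n)

n<2^suc⌊log₂n⌋ : ∀ n → n < 2 ^ suc ⌊log₂ n ⌋
n<2^suc⌊log₂n⌋ n = ≰⇒> (λ 2^suc≤n → n≮n _ (⌊log₂⌋-≥ 2^suc≤n))

2^⌊log₂n⌋≤n : ∀ n → 0 < n → 2 ^ ⌊log₂ n ⌋ ≤ n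
2^⌊log₂n⌋≤n = <-rec (λ n → 0 < n → 2 ^ ⌊log₂ n ⌋ ≤ n) step
  where
  step : ∀ n → (∀ {k} → k < n → 0 < k → 2 ^ ⌊log₂ k ⌋ ≤ k) → 0 < n → 2 ^ ⌊log₂ n ⌋ ≤ n
  step 1                  _   _ = ≤-refl
  step n@(suc (suc n′)) rec _ = begin  -- ⌊log₂ n⌋ reduces to a successor here
    2 ^ ⌊log₂ n ⌋                  ≡⟨ cong (λ k → 2 * 2 ^ k) (sym (⌊log₂⌊n/2⌋⌋≡⌊log₂n⌋∸1 n)) ⟩
    2 * 2 ^ ⌊log₂ ⌊ n /2⌋ ⌋        ≤⟨ *-monoʳ-≤ 2 (rec (⌊n/2⌋<n (suc n′)) z<s) ⟩
    ⌊ n /2⌋ + (⌊ n /2⌋ + 0)        ≤⟨ +-monoʳ-≤ ⌊ n /2⌋ (≤-trans (≤-reflexive (+-identityʳ _)) (⌊n/2⌋≤⌈n/2⌉ n)) ⟩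
    ⌊ n /2⌋ + ⌈ n /2⌉              ≡⟨ ⌊n/2⌋+⌈n/2⌉≡n n ⟩
    n                              ∎
    where open ≤-Reasoning

n<2^n : ∀ n → n < 2 ^ n
n<2^n zero    = z<s
n<2^n (suc n) = +-mono-≤ (m^n>0 2 n) (≤-trans (n<2^n n) (m≤m+n (2 ^ n) 0))

⌊log₂⌋-positive : ∀ {n} → 0 < ⌊log₂ n ⌋ → 0 < n
⌊log₂⌋-positive {suc n} _ = z<s

module Parameters (a s n : ℕ) (L≤a*l : ⌊log₂ ⌊log₂ n ⌋ ⌋ ≤ a * ⌊log₂ s ⌋)
                  (large : 6 * suc a ≤ ⌊log₂ ⌊log₂ n ⌋ ⌋) where

  m L l v u : ℕ
  m = ⌊log₂ n ⌋
  L = ⌊log₂ m ⌋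
  l = ⌊log₂ s ⌋
  v = l ⊓ L
  u = v ∸ 2

  L≤[1+a]*v : L ≤ suc a * v
  L≤[1+a]*v = begin
    L                           ≤⟨ ⊓-glb (≤-trans L≤a*l (*-monoˡ-≤ l (n≤1+n a))) (m≤n*m L (suc a)) ⟩
    (suc a * l) ⊓ (suc a * L)   ≡⟨ sym (*-distribˡ-⊓ (suc a) l L) ⟩
    suc a * v                   ∎
    where open ≤-Reasoning

  6≤v : 6 ≤ v
  6≤v = *-cancelˡ-≤ (suc a) (≤-trans (≤-reflexive (*-comm (suc a) 6)) (≤-trans large L≤[1+a]*v))

  u+2≡v : u + 2 ≡ v
  u+2≡v = m∸n+n≡m (≤-trans (s≤s (s≤s z≤n)) 6≤v)

  4≤u : 4 ≤ u
  4≤u = ∸-monoˡ-≤ 2 6≤v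

  L≤[1+a]*[2*u] : L ≤ suc a * (2 * u)
  L≤[1+a]*[2*u] = begin
    L                  ≤⟨ L≤[1+a]*v ⟩
    suc a * v          ≡⟨ cong (suc a *_) (sym u+2≡v) ⟩
    suc a * (u + 2)    ≤⟨ *-monoʳ-≤ (suc a) (+-monoʳ-≤ u (≤-trans (m≤m+n 2 2) 4≤u)) ⟩
    suc a * (u + u)    ≡⟨ cong (λ k → suc a * (u + k)) (sym (+-identityʳ u)) ⟩
    suc a * (2 * u)    ∎
    where open ≤-Reasoning

  2^L≤m : 2 ^ L ≤ m
  2^L≤m = 2^⌊log₂n⌋≤n m (⌊log₂⌋-positive (≤-trans (s≤s z≤n) (≤-trans 6≤v (m⊓n≤n l L))))

  2^l≤s : 2 ^ l ≤ s
  2^l≤s = 2^⌊log₂n⌋≤n s (⌊log₂⌋-positive (≤-trans (s≤s z≤n) (≤-trans 6≤v (m⊓n≤m l L))))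

  2^v≤m : 2 ^ v ≤ m
  2^v≤m = ≤-trans (^-monoʳ-≤ 2 (m⊓n≤n l L)) 2^L≤m

  8≤m : 8 ≤ m
  8≤m = ≤-trans (^-monoʳ-≤ 2 (≤-trans (m≤m+n 3 3) 6≤v)) 2^v≤m

  h : ℕ
  h = 2 ^ u

  h<s : h < s
  h<s = begin-strict
    2 ^ u        <⟨ ^-monoʳ-< 2 (s≤s (s≤s z≤n)) (n<1+n u) ⟩
    2 ^ suc u    ≤⟨ ^-monoʳ-≤ 2 (≤-trans (n≤1+n (suc u)) (≤-reflexive (trans (+-comm 2 u) u+2≡v))) ⟩
    2 ^ v        ≤⟨ ^-monoʳ-≤ 2 (m⊓n≤m l L) ⟩
    2 ^ l        ≤⟨ 2^l≤s ⟩
    s            ∎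
    where open ≤-Reasoning

  instance
    u≢0 : NonZero u
    u≢0 = >-nonZero (≤-trans (s≤s z≤n) 4≤u)

  k₁ : ℕ
  k₁ = m / u + 1

  m<u*k₁ : m < u * k₁
  m<u*k₁ = begin-strict
    m                    ≡⟨ m≡m%n+[m/n]*n m u ⟩
    m % u + m / u * u    <⟨ +-monoˡ-< (m / u * u) (m%n<n m u) ⟩
    u + m / u * u        ≡⟨ cong (u +_) (*-comm (m / u) u) ⟩
    u + u * (m / u)      ≡⟨ sym (*-suc u (m / u)) ⟩
    u * suc (m / u)      ≡⟨ cong (u *_) (+-comm 1 (m / u)) ⟩
    u * k₁               ∎
    where open ≤-Reasoning

  4*k₁≤m+4 : 4 * k₁ ≤ m + 4
  4*k₁≤m+4 = begin
    4 * (m / u + 1)      ≡⟨ *-distribˡ-+ 4 (m / u) 1 ⟩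
    4 * (m / u) + 4      ≤⟨ +-monoˡ-≤ 4 (*-monoˡ-≤ (m / u) 4≤u) ⟩
    u * (m / u) + 4      ≤⟨ +-monoˡ-≤ 4 (≤-trans (≤-reflexive (*-comm u (m / u))) (m/n*n≤m m u)) ⟩
    m + 4                ∎
    where open ≤-Reasoning

  4*suc[h]≤m+4 : 4 * suc h ≤ m + 4
  4*suc[h]≤m+4 = begin
    4 * suc h            ≡⟨ *-suc 4 h ⟩
    4 + 4 * h            ≡⟨ +-comm 4 (4 * h) ⟩
    4 * h + 4            ≡⟨ cong (_+ 4) (trans (*-assoc 2 2 h) (cong (2 ^_) u+2≡v′)) ⟩
    2 ^ v + 4            ≤⟨ +-monoˡ-≤ 4 2^v≤m ⟩
    m + 4                ∎
    where
    open ≤-Reasoning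
    u+2≡v′ : 2 + u ≡ v
    u+2≡v′ = trans (+-comm 2 u) u+2≡v

  k₂ : ℕ
  k₂ = m ∸ (suc h + k₁)

  m+4*[1+h+k₁]≤4*m : m + 4 * (suc h + k₁) ≤ 4 * m
  m+4*[1+h+k₁]≤4*m = begin
    m + 4 * (suc h + k₁)          ≡⟨ cong (m +_) (*-distribˡ-+ 4 (suc h) k₁) ⟩
    m + (4 * suc h + 4 * k₁)      ≤⟨ +-monoʳ-≤ m (+-mono-≤ 4*suc[h]≤m+4 4*k₁≤m+4) ⟩
    m + ((m + 4) + (m + 4))       ≡⟨ rearrange m ⟩
    3 * m + 8                     ≤⟨ +-monoʳ-≤ (3 * m) 8≤m ⟩
    3 * m + m                     ≡⟨ +-comm (3 * m) m ⟩
    4 * m                         ∎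
    where
    open ≤-Reasoning
    rearrange : ∀ m → m + ((m + 4) + (m + 4)) ≡ 3 * m + 8
    rearrange = solve-∀

  1+h+k₁≤m : suc h + k₁ ≤ m
  1+h+k₁≤m = *-cancelˡ-≤ 4 (≤-trans (m≤n+m _ m) m+4*[1+h+k₁]≤4*m)

  m≤4*k₂ : m ≤ 4 * k₂
  m≤4*k₂ = subst (m ≤_) (sym (*-distribˡ-∸ 4 m (suc h + k₁))) (m+n≤o⇒m≤o∸n m m+4*[1+h+k₁]≤4*m)

  block-length : suc h + (k₁ + k₂) ≡ m
  block-length = trans (sym (+-assoc (suc h) k₁ k₂)) (m+[n∸m]≡n 1+h+k₁≤m)

  instance
    m≢0 : NonZero m
    m≢0 = >-nonZero (≤-trans (s≤s z≤n) 8≤m)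

  B z : ℕ
  B = n / m
  z = n % m

  n≡B*m+z : B * m + z ≡ n
  n≡B*m+z = trans (+-comm (B * m) z) (sym (m≡m%n+[m/n]*n n m))

  B≤h^k₁ : B ≤ h ^ k₁
  B≤h^k₁ = begin
    n / m          ≤⟨ m/n≤m n m ⟩
    n              <⟨ n<2^suc⌊log₂n⌋ n ⟩
    2 ^ suc m      ≤⟨ ^-monoʳ-≤ 2 m<u*k₁ ⟩
    2 ^ (u * k₁)   ≡⟨ sym (^-*-assoc 2 u k₁) ⟩
    h ^ k₁         ∎
    where open ≤-Reasoning

  m≤n : m ≤ n
  m≤n = <⇒≤ (<-≤-trans (n<2^n m) (2^⌊log₂n⌋≤n n (⌊log₂⌋-positive (≤-trans (s≤s z≤n) 8≤m))))

  n≤8*[B*k₂] : n ≤ 8 * (B * k₂)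
  n≤8*[B*k₂] = begin
    n                 ≡⟨ sym n≡B*m+z ⟩
    B * m + z         ≤⟨ +-monoʳ-≤ (B * m) (<⇒≤ (m%n<n n m)) ⟩
    B * m + m         ≤⟨ +-monoʳ-≤ (B * m) (m≤n*m m B {{>-nonZero (m≥n⇒m/n>0 m≤n)}}) ⟩
    B * m + B * m     ≤⟨ +-mono-≤ (*-monoʳ-≤ B m≤4*k₂) (*-monoʳ-≤ B m≤4*k₂) ⟩
    B * (4 * k₂) + B * (4 * k₂) ≡⟨ rearrange B k₂ ⟩
    8 * (B * k₂)      ∎
    where
    open ≤-Reasoning
    rearrange : ∀ B k₂ → B * (4 * k₂) + B * (4 * k₂) ≡ 8 * (B * k₂)
    rearrange = solve-∀

  E : ℕ
  E = u * (k₂ * B)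

  2^E≡[h^k₂]^B : 2 ^ E ≡ (h ^ k₂) ^ B
  2^E≡[h^k₂]^B = sym (trans (^-*-assoc h k₂ B) (^-*-assoc 2 u (k₂ * B)))

  n*L≤16*[1+a]*E : n * L ≤ 16 * suc a * E
  n*L≤16*[1+a]*E = begin
    n * L                                  ≤⟨ *-mono-≤ n≤8*[B*k₂] L≤[1+a]*[2*u] ⟩
    8 * (B * k₂) * (suc a * (2 * u))       ≡⟨ rearrange B k₂ (suc a) u ⟩
    16 * suc a * (u * (k₂ * B))            ∎
    where
    open ≤-Reasoning
    rearrange : ∀ B k₂ a u → 8 * (B * k₂) * (a * (2 * u)) ≡ 16 * a * (u * (k₂ * B))
    rearrange = solve-∀

  layout : Layout s n m
  layout = record
    { h = h ; k₁ = k₁ ; k₂ = k₂ ; B = B ; z = z ; h≢0 = m^n≢0 2 u ; h<s = h<s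
    ; block-length = block-length ; n≡B*m+z = n≡B*m+z ; z<m = m%n<n n m ; B≤h^k₁ = B≤h^k₁ }

theorem10 : (σ : ℕ → ℕ)
    → Σ ℕ (λ a → Σ ℕ (λ N₀ → (n : ℕ) → N₀ ≤ n → ⌊log₂ ⌊log₂ n ⌋ ⌋ ≤ a * ⌊log₂ σ n ⌋))
    → Σ ℕ (λ c → Σ ℕ (λ N₁ → (n : ℕ) → N₁ ≤ n
        → (D : OPPMEncoding (σ n) n ⌊log₂ n ⌋)
        → Σ _ (λ S → n * ⌊log₂ ⌊log₂ n ⌋ ⌋ ≤ c * bitsUsed D S)))
theorem10 σ (a , N₀ , L≤a*lgσ) = 16 * suc a , N₀ + 2 ^ 2 ^ (6 * suc a) , bound
  where
  bound : ∀ n → N₀ + 2 ^ 2 ^ (6 * suc a) ≤ n → (D : OPPMEncoding (σ n) n ⌊log₂ n ⌋) →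
          Σ _ (λ S → n * ⌊log₂ ⌊log₂ n ⌋ ⌋ ≤ 16 * suc a * bitsUsed D S)
  bound n n≥ D =
    let S , E≤bits = Layout-lower-bound layout D E (≤-reflexive 2^E≡[h^k₂]^B)
    in  S , ≤-trans n*L≤16*[1+a]*E (*-monoʳ-≤ (16 * suc a) E≤bits)
    where
    open Parameters a (σ n) n (L≤a*lgσ n (≤-trans (m≤m+n N₀ _) n≥))
                      (⌊log₂⌋-≥ (⌊log₂⌋-≥ (≤-trans (m≤n+m _ N₀) n≥)))
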